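{- Let $G=(I\cup C,E)$ and the word $w$ be as in the context. For $a \in I$ and $b \in C$, if $a$ and $b$ are not adjacent in $G$, then $a$ and $b$ do not alternate in $w$.
   Context: For a word $w$ and letters $a,b$, $w|_{\{a,b\}}$ is the subsequence of $w$ of all occurrences of $a,b$; $a,b$ alternate in $w$ if $w|_{\{a,b\}}$ is $abab\cdots$ or $baba\cdots$ (any length). Let $G=(I\cup C,E)$ be a split graph, $I$ independent, $C$ a clique, with $C$ inclusion-wise maximal (no vertex of $I$ is adjacent to all of $C$). For integers $x\le y$ write $[x,y]=\{x,\dots,y\}$. Assume the vertices of $C$ are labelled $1,\dots,k$ ($k=|C|$) so that for all $a,b\in I$: (i) either $N(a)=[1,m]\cup[n,k]$ for some $m<n$, or $N(a)=[l,r]$ for some $l\le r$; (ii) if $N(a)=[1,m]\cup[n,k]$ ($m<n$) and $N(b)=[l,r]$ ($l\le r$) then $l>m$ or $r<n$; (iii) if $N(a)=[1,m]\cup[n,k]$ and $N(b)=[1,m']\cup[n',k]$ ($m<n$, $m'<n'$) then $m'<n$ and $m<n'$. Let $A$ be the set of $a\in I$ whose neighbourhood is of the form $[1,m]\cup[n,k]$ with $1\le m$, $m+1<n\le k$ (not an interval), and $B$ the set of $a\in I$ with $N(a)$ an interval $[l,r]$; $I=A\cup B$ disjointly. Construction: initialise $p_1=p_2=p_3=12\cdots k$ and $d=1$. For each $a\in I$ in turn: if $a\in A$ with $N(a)=[1,m]\cup[n,k]$, set $d:=m$ if $m>d$, insert $a$ immediately after the letter $m$ in $p_1$ and immediately before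 the letter $n$ in $p_2$; if $a\in B$ with $N(a)=[l,r]$, insert $a$ immediately before $l$ in $p_1$ and immediately after $r$ in $p_2$. Then replace the letter $d$ in $p_3$ by $d\,(p_1|_A)^R$ ($p_1|_A$ the subsequence of $p_1$ of letters in $A$, $^R$ reversal). Set $w=p_1\,(p_1|_B)^R\,p_2\,p_3$, a 3-uniform word over $I\cup C$. -}

module Defs where

open import Data.Nat using (ℕ; zero; suc; _+_; _≤_; _<_; _⊔_)
open import Data.Nat.Properties using () renaming (_≟_ to _≟ℕ_)
open import Data.Fin using (Fin) renaming (_≟_ to _≟F_)
open import Data.Bool using (Bool; true; false)
open import Data.List using (List; []; _∷_; _++_; map; foldl; reverse; filterᵇ; allFin)
open import Data.Product using (_×_; _,_)
open import Data.Sum using (_⊎_)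
open import Relation.Nullary using (¬_; Dec; yes; no)
open import Relation.Binary.PropositionalEquality using (_≡_; refl; cong)

-- Neighbourhood descriptor of a vertex of I (clique C = {1,…,k}).
--   nbA m n : N(a) = [1,m] ∪ [n,k]  (the set A)
--   nbB l r : N(a) = [l,r]          (the set B)
data Nbhd : Set where
  nbA : ℕ → ℕ → Nbhd
  nbB : ℕ → ℕ → Nbhd

Adj : ℕ → Nbhd → ℕ → Set
Adj k (nbA m n) b = (1 ≤ b × b ≤ m) ⊎ (n ≤ b × b ≤ k)
Adj k (nbB l r) b = l ≤ b × b ≤ r

-- well-formedness of a descriptor: condition (i), definition of A / B,
-- and maximality of C (no vertex of I adjacent to all of C)
WellFormed : ℕ → Nbhd → Set
WellFormed k (nbA m n) = 1 ≤ m × suc m < n × n ≤ k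
WellFormed k (nbB l r) = 1 ≤ l × l ≤ r × r ≤ k × ¬ (l ≡ 1 × r ≡ k)

Cond2 : Nbhd → Nbhd → Set
Cond2 (nbA m n) (nbB l r) = m < l ⊎ r < n
Cond2 _ _ = Data.Unit.⊤
  where import Data.Unit

Cond3 : Nbhd → Nbhd → Set
Cond3 (nbA m n) (nbA m' n') = m' < n × m < n'
Cond3 _ _ = Data.Unit.⊤
  where import Data.Unit

-- letters of the word: clique vertices (labels 1..k) and vertices of I = Fin s
data Letter (s : ℕ) : Set where
  cl : ℕ → Letter s
  iv : Fin s → Letter s

_≟L_ : ∀ {s} (x y : Letter s) → Dec (x ≡ y)
cl i ≟L cl j with i ≟ℕ j
... | yes refl = yes refl
... | no ne = no λ { refl → ne refl }
cl _ ≟L iv _ = no λ ()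
iv _ ≟L cl _ = no λ ()
iv a ≟L iv b with a ≟F b
... | yes refl = yes refl
... | no ne = no λ { refl → ne refl }

insertAfterL : ∀ {s} → Letter s → List (Letter s) → List (Letter s) → List (Letter s)
insertAfterL x ys [] = []
insertAfterL x ys (z ∷ zs) with z ≟L x
... | yes _ = z ∷ ys ++ zs
... | no _ = z ∷ insertAfterL x ys zs

insertAfter : ∀ {s} → Letter s → Letter s → List (Letter s) → List (Letter s)
insertAfter x y = insertAfterL x (y ∷ [])

insertBefore : ∀ {s} → Letter s → Letter s → List (Letter s) → List (Letter s)
insertBefore x y [] = []
insertBefore x y (z ∷ zs) with z ≟L x
... | yes _ = y ∷ z ∷ zs
... | no _ = z ∷ insertBefore x y zs

initPerm : ∀ {s} → ℕ → List (Letter s)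
initPerm k = map (λ i → cl (suc i)) (Data.List.upTo k)

module Construction (k s : ℕ) (N : Fin s → Nbhd) where

  step1 : List (Letter s) → Fin s → List (Letter s)
  step1 p a with N a
  ... | nbA m n = insertAfter (cl m) (iv a) p
  ... | nbB l r = insertBefore (cl l) (iv a) p

  step2 : List (Letter s) → Fin s → List (Letter s)
  step2 p a with N a
  ... | nbA m n = insertBefore (cl n) (iv a) p
  ... | nbB l r = insertAfter (cl r) (iv a) p

  stepd : ℕ → Fin s → ℕ
  stepd d a with N a
  ... | nbA m n = d ⊔ m
  ... | nbB l r = d

  p1 p2 : List (Letter s)
  p1 = foldl step1 (initPerm k) (allFin s)
  p2 = foldl step2 (initPerm k) (allFin s)

  d : ℕ
  d = foldl stepd 1 (allFin s)

  isA isB : Letter s → Bool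
  isA (cl _) = false
  isA (iv a) with N a
  ... | nbA _ _ = true
  ... | nbB _ _ = false
  isB (cl _) = false
  isB (iv a) with N a
  ... | nbA _ _ = false
  ... | nbB _ _ = true

  p3 : List (Letter s)
  p3 = insertAfterL (cl d) (reverse (filterᵇ isA p1)) (initPerm k)

  w : List (Letter s)
  w = p1 ++ reverse (filterᵇ isB p1) ++ p2 ++ p3

data AltFrom {s} (x y : Letter s) : List (Letter s) → Set where
  alt[] : AltFrom x y []
  alt∷ : ∀ {u} → AltFrom y x u → AltFrom x y (x ∷ u)

restrict : ∀ {s} → Letter s → Letter s → List (Letter s) → List (Letter s)
restrict x y [] = []
restrict x y (z ∷ zs) with z ≟L x | z ≟L y
... | no _ | no _ = restrict x y zs
... | _ | _ = z ∷ restrict x y zs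

Alternate : ∀ {s} → Letter s → Letter s → List (Letter s) → Set
Alternate x y u = AltFrom x y (restrict x y u) ⊎ AltFrom y x (restrict x y u)

module Submission where

-- Restriction to a set of letters commutes with the insertions building p₁ and p₂. In p₁ (resp. p₂)
-- the vertex a is inserted next to one clique vertex t, its anchor (m or l, resp. n or r), and no
-- other insertion involves a, b or t, so a lands on the same side of b as t. As b ∉ N(a), every
-- anchor lies strictly on one side of b, and w restricted to {a, b} starts with  a b b a  (a ∈ A,
-- m < b < n),  b a a  (a ∈ B, b < l; the second a comes from (p₁|_B)ᴿ) or  a b a a b  (a ∈ B,
-- r < b). An alternating word has no factor x x, so a and b do not alternate.

open import Defs
open import Level using (Level)
open import Function using (_∘_)
open import Data.Nat using (ℕ; zero; suc; _≤_; _<_; s≤s; _≤?_)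
open import Data.Nat.Properties
  using (≰⇒>; <⇒≢; >⇒≢; ≤-trans; ≤-<-trans; <-≤-trans; suc-injective; 1+n≢0; 0≢1+n)
open import Data.Fin using (Fin)
open import Data.List using (List; []; _∷_; [_]; _++_; filter; filterᵇ; foldl; reverse; applyUpTo; allFin)
open import Data.List.Properties
  using (filter-accept; filter-reject; filter-++; filter-≐; unfold-reverse; ++-identityʳ; map-upTo)
open import Data.List.Relation.Unary.All using (All; []; _∷_; lookup)
open import Data.List.Relation.Unary.AllPairs using (_∷_)
open import Data.List.Relation.Unary.Any using (here; there)
open import Data.List.Relation.Unary.Unique.Propositional using (Unique)
open import Data.List.Relation.Unary.Unique.Propositional.Properties using (allFin⁺)
open import Data.List.Membership.Propositional using (_∈_)
open import Data.List.Membership.Propositional.Properties using (∈-allFin)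
open import Data.Product using (_,_; proj₂; swap)
open import Data.Sum using (_⊎_; inj₁; inj₂)
import Data.Sum as Sum
open import Relation.Nullary using (¬_; yes; no; contradiction; _⊎-dec_)
open import Relation.Nullary.Decidable using (T?)
open import Relation.Unary using (Pred; Decidable; _⊆_; _≐_)
open import Relation.Unary.Properties using (_∩?_)
open import Relation.Binary.PropositionalEquality hiding ([_])

private variable
  ℓ ℓ₁ ℓ₂ : Level
  A B : Set ℓ

module _ {P : Pred A ℓ₁} {Q : Pred A ℓ₂} (P? : Decidable P) (Q? : Decidable Q) where

  filter-filter : ∀ xs → filter P? (filter Q? xs) ≡ filter (Q? ∩? P?) xs
  filter-filter [] = refl
  filter-filter (x ∷ xs) with Q? x
  ... | no _ = filter-filter xs
  ... | yes _ with P? x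
  ...   | yes _ = cong (x ∷_) (filter-filter xs)
  ...   | no _  = filter-filter xs

module _ {P : Pred A ℓ₁} {Q : Pred A ℓ₂} (P? : Decidable P) (Q? : Decidable Q) where

  filter-comm : ∀ xs → filter P? (filter Q? xs) ≡ filter Q? (filter P? xs)
  filter-comm xs = begin
    filter P? (filter Q? xs) ≡⟨ filter-filter P? Q? xs ⟩
    filter (Q? ∩? P?) xs     ≡⟨ filter-≐ (Q? ∩? P?) (P? ∩? Q?) (swap , swap) xs ⟩
    filter (P? ∩? Q?) xs     ≡⟨ filter-filter Q? P? xs ⟨
    filter Q? (filter P? xs) ∎
    where open ≡-Reasoning

  filter-filter-⊆ : Q ⊆ P → ∀ xs → filter Q? (filter P? xs) ≡ filter Q? xs
  filter-filter-⊆ Q⊆P xs = begin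
    filter Q? (filter P? xs) ≡⟨ filter-filter Q? P? xs ⟩
    filter (P? ∩? Q?) xs     ≡⟨ filter-≐ (P? ∩? Q?) Q? (proj₂ , λ q → Q⊆P q , q) xs ⟩
    filter Q? xs             ∎
    where open ≡-Reasoning

module _ {P : Pred A ℓ₁} (P? : Decidable P) where

  filter-∷-cong : ∀ z {xs ys} → filter P? xs ≡ filter P? ys → filter P? (z ∷ xs) ≡ filter P? (z ∷ ys)
  filter-∷-cong z eq with P? z
  ... | yes _ = cong (z ∷_) eq
  ... | no _  = eq

  reverse-filter-∷ : ∀ x xs → reverse (filter P? (x ∷ xs)) ≡ reverse (filter P? xs) ++ filter P? [ x ]
  reverse-filter-∷ x xs with P? x
  ... | yes _ = unfold-reverse x (filter P? xs)
  ... | no _  = sym (++-identityʳ (reverse (filter P? xs)))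

  filter-reverse : ∀ xs → filter P? (reverse xs) ≡ reverse (filter P? xs)
  filter-reverse [] = refl
  filter-reverse (x ∷ xs) = begin
    filter P? (reverse (x ∷ xs))              ≡⟨ cong (filter P?) (unfold-reverse x xs) ⟩
    filter P? (reverse xs ++ [ x ])           ≡⟨ filter-++ P? (reverse xs) [ x ] ⟩
    filter P? (reverse xs) ++ filter P? [ x ] ≡⟨ cong (_++ filter P? [ x ]) (filter-reverse xs) ⟩
    reverse (filter P? xs) ++ filter P? [ x ] ≡⟨ reverse-filter-∷ x xs ⟨
    reverse (filter P? (x ∷ xs))              ∎
    where open ≡-Reasoning

module _ {P : Pred A ℓ₁} (P? : Decidable P) (f : List A → B → List A) {b : B}
         (f-invisible : ∀ {c} xs → c ≢ b → filter P? (f xs c) ≡ filter P? xs) where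

  filter-foldl-∌ : ∀ {cs} → All (b ≢_) cs → ∀ xs → filter P? (foldl f xs cs) ≡ filter P? xs
  filter-foldl-∌ [] xs = refl
  filter-foldl-∌ {c ∷ cs} (b≢c ∷ b∉cs) xs =
    trans (filter-foldl-∌ b∉cs (f xs c)) (f-invisible xs (b≢c ∘ sym))

  filter-foldl-unique : (g : List A → List A) → (∀ xs → filter P? (f xs b) ≡ g (filter P? xs)) →
    ∀ {cs} → Unique cs → b ∈ cs → ∀ xs → filter P? (foldl f xs cs) ≡ g (filter P? xs)
  filter-foldl-unique g f-b (b∉cs ∷ _) (here refl) xs =
    trans (filter-foldl-∌ b∉cs (f xs b)) (f-b xs)
  filter-foldl-unique g f-b {c ∷ _} (c∉cs ∷ unique) (there b∈cs) xs =
    trans (filter-foldl-unique g f-b unique b∈cs (f xs c))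
          (cong g (f-invisible xs (lookup c∉cs b∈cs)))

module _ {P : Pred A ℓ₁} (P? : Decidable P) where

  filter-applyUpTo-none : ∀ (f : ℕ → A) n → (∀ j → ¬ P (f j)) → filter P? (applyUpTo f n) ≡ []
  filter-applyUpTo-none f zero    _  = refl
  filter-applyUpTo-none f (suc n) ¬P =
    trans (filter-reject P? (¬P 0)) (filter-applyUpTo-none (f ∘ suc) n (¬P ∘ suc))

  filter-applyUpTo-one : ∀ (f : ℕ → A) {n x} → x < n → P (f x) → (∀ j → P (f j) → j ≡ x) →
    filter P? (applyUpTo f n) ≡ f x ∷ []
  filter-applyUpTo-one f {suc n} {zero} _ Px only =
    trans (filter-accept P? Px)
          (cong (f 0 ∷_) (filter-applyUpTo-none (f ∘ suc) n (λ j → 1+n≢0 ∘ only (suc j))))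
  filter-applyUpTo-one f {suc n} {suc x} (s≤s x<n) Px only =
    trans (filter-reject P? (0≢1+n ∘ only 0))
          (filter-applyUpTo-one (f ∘ suc) x<n Px (λ j → suc-injective ∘ only (suc j)))

  filter-applyUpTo-two : ∀ (f : ℕ → A) {n x y} → x < y → y < n → P (f x) → P (f y) →
    (∀ j → P (f j) → j ≡ x ⊎ j ≡ y) → filter P? (applyUpTo f n) ≡ f x ∷ f y ∷ []
  filter-applyUpTo-two f {suc n} {zero} {suc y} _ (s≤s y<n) Px Py only =
    trans (filter-accept P? Px)
          (cong (f 0 ∷_) (filter-applyUpTo-one (f ∘ suc) y<n Py (λ j → not-zero j ∘ only (suc j))))
    where
    not-zero : ∀ j → suc j ≡ 0 ⊎ suc j ≡ suc y → j ≡ y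
    not-zero j (inj₂ eq) = suc-injective eq
  filter-applyUpTo-two f {suc n} {suc x} {suc y} (s≤s x<y) (s≤s y<n) Px Py only =
    trans (filter-reject P? (Sum.[ 0≢1+n , 0≢1+n ] ∘ only 0))
          (filter-applyUpTo-two (f ∘ suc) x<y y<n Px Py
            (λ j → Sum.map suc-injective suc-injective ∘ only (suc j)))

module _ {s : ℕ} where
  open import Data.List.Membership.DecPropositional (_≟L_ {s}) using (_∈?_)

  private
    L : Set
    L = Letter s

  infixl 6 _↾_
  _↾_ : List L → List L → List L
  w ↾ S = filter (_∈? S) w

  restrict-filter : ∀ (x y : L) w → restrict x y w ≡ filter (λ z → z ≟L x ⊎-dec z ≟L y) w
  restrict-filter x y [] = refl
  restrict-filter x y (z ∷ zs) with z ≟L x | z ≟L y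
  ... | yes _ | _     = cong (z ∷_) (restrict-filter x y zs)
  ... | no _  | yes _ = cong (z ∷_) (restrict-filter x y zs)
  ... | no _  | no _  = restrict-filter x y zs

  restrict-↾ : ∀ (x y : L) w → restrict x y w ≡ w ↾ (x ∷ y ∷ [])
  restrict-↾ x y w =
    trans (restrict-filter x y w)
          (filter-≐ (λ z → z ≟L x ⊎-dec z ≟L y) (_∈? (x ∷ y ∷ [])) ≐-pair w)
    where
    ≐-pair : (λ z → z ≡ x ⊎ z ≡ y) ≐ (_∈ x ∷ y ∷ [])
    ≐-pair = Sum.[ here , there ∘ here ]
           , λ { (here z≡x) → inj₁ z≡x ; (there (here z≡y)) → inj₂ z≡y }

  insertAfter-head : ∀ (x v : L) ys → insertAfter x v (x ∷ ys) ≡ x ∷ v ∷ ys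
  insertAfter-head x v ys with x ≟L x
  ... | yes _  = refl
  ... | no x≢x = contradiction refl x≢x

  insertAfter-cons : ∀ {x y : L} v ys → y ≢ x → insertAfter x v (y ∷ ys) ≡ y ∷ insertAfter x v ys
  insertAfter-cons {x} {y} v ys y≢x with y ≟L x
  ... | yes y≡x = contradiction y≡x y≢x
  ... | no _    = refl

  insertBefore-head : ∀ (x v : L) ys → insertBefore x v (x ∷ ys) ≡ v ∷ x ∷ ys
  insertBefore-head x v ys with x ≟L x
  ... | yes _  = refl
  ... | no x≢x = contradiction refl x≢x

  insertBefore-cons : ∀ {x y : L} v ys → y ≢ x → insertBefore x v (y ∷ ys) ≡ y ∷ insertBefore x v ys
  insertBefore-cons {x} {y} v ys y≢x with y ≟L x
  ... | yes y≡x = contradiction y≡x y≢x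
  ... | no _    = refl

  module _ {P : Pred L ℓ} (P? : Decidable P) {x v : L} where

    filter-insertAfter-reject : ¬ P v → ∀ ys → filter P? (insertAfter x v ys) ≡ filter P? ys
    filter-insertAfter-reject ¬Pv [] = refl
    filter-insertAfter-reject ¬Pv (y ∷ ys) with y ≟L x
    ... | yes _ = filter-∷-cong P? y (filter-reject P? ¬Pv)
    ... | no _  = filter-∷-cong P? y (filter-insertAfter-reject ¬Pv ys)

    filter-insertBefore-reject : ¬ P v → ∀ ys → filter P? (insertBefore x v ys) ≡ filter P? ys
    filter-insertBefore-reject ¬Pv [] = refl
    filter-insertBefore-reject ¬Pv (y ∷ ys) with y ≟L x
    ... | yes _ = filter-reject P? ¬Pv
    ... | no _  = filter-∷-cong P? y (filter-insertBefore-reject ¬Pv ys)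

    filter-insertAfter-accept : P x → P v → ∀ ys →
      filter P? (insertAfter x v ys) ≡ insertAfter x v (filter P? ys)
    filter-insertAfter-accept Px Pv [] = refl
    filter-insertAfter-accept Px Pv (y ∷ ys) with y ≟L x
    ... | yes refl = begin
      filter P? (x ∷ v ∷ ys)                ≡⟨ filter-accept P? Px ⟩
      x ∷ filter P? (v ∷ ys)                ≡⟨ cong (x ∷_) (filter-accept P? Pv) ⟩
      x ∷ v ∷ filter P? ys                  ≡⟨ insertAfter-head x v (filter P? ys) ⟨
      insertAfter x v (x ∷ filter P? ys)    ≡⟨ cong (insertAfter x v) (filter-accept P? Px) ⟨
      insertAfter x v (filter P? (x ∷ ys))  ∎
      where open ≡-Reasoning
    ... | no y≢x with P? y
    ...   | yes _ = trans (cong (y ∷_) (filter-insertAfter-accept Px Pv ys))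
                          (sym (insertAfter-cons v (filter P? ys) y≢x))
    ...   | no _  = filter-insertAfter-accept Px Pv ys

    filter-insertBefore-accept : P x → P v → ∀ ys →
      filter P? (insertBefore x v ys) ≡ insertBefore x v (filter P? ys)
    filter-insertBefore-accept Px Pv [] = refl
    filter-insertBefore-accept Px Pv (y ∷ ys) with y ≟L x
    ... | yes refl = begin
      filter P? (v ∷ x ∷ ys)                 ≡⟨ filter-accept P? Pv ⟩
      v ∷ filter P? (x ∷ ys)                 ≡⟨ cong (v ∷_) (filter-accept P? Px) ⟩
      v ∷ x ∷ filter P? ys                   ≡⟨ insertBefore-head x v (filter P? ys) ⟨
      insertBefore x v (x ∷ filter P? ys)    ≡⟨ cong (insertBefore x v) (filter-accept P? Px) ⟨
      insertBefore x v (filter P? (x ∷ ys))  ∎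
      where open ≡-Reasoning
    ... | no y≢x with P? y
    ...   | yes _ = trans (cong (y ∷_) (filter-insertBefore-accept Px Pv ys))
                          (sym (insertBefore-cons v (filter P? ys) y≢x))
    ...   | no _  = filter-insertBefore-accept Px Pv ys

  data Beside (x v : L) : (List L → List L) → Set where
    after  : Beside x v (insertAfter x v)
    before : Beside x v (insertBefore x v)

  beside-cons : ∀ {x v y g} → Beside x v g → y ≢ x → ∀ ys → g (y ∷ ys) ≡ y ∷ g ys
  beside-cons after  y≢x ys = insertAfter-cons _ ys y≢x
  beside-cons before y≢x ys = insertBefore-cons _ ys y≢x

  module _ {P : Pred L ℓ} (P? : Decidable P) {x v : L} where

    filter-beside-reject : ∀ {g} → Beside x v g → ¬ P v → ∀ ys → filter P? (g ys) ≡ filter P? ys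
    filter-beside-reject after  = filter-insertAfter-reject P?
    filter-beside-reject before = filter-insertBefore-reject P?

    filter-beside-accept : ∀ {g} → Beside x v g → P x → P v → ∀ ys → filter P? (g ys) ≡ g (filter P? ys)
    filter-beside-accept after  = filter-insertAfter-accept P?
    filter-beside-accept before = filter-insertBefore-accept P?

    filter-beside-head : ∀ {g} → Beside x v g → ¬ P x → P v → ∀ ys →
      filter P? (g (x ∷ ys)) ≡ v ∷ filter P? ys
    filter-beside-head after ¬Px Pv ys = begin
      filter P? (insertAfter x v (x ∷ ys))  ≡⟨ cong (filter P?) (insertAfter-head x v ys) ⟩
      filter P? (x ∷ v ∷ ys)                ≡⟨ filter-reject P? ¬Px ⟩
      filter P? (v ∷ ys)                    ≡⟨ filter-accept P? Pv ⟩
      v ∷ filter P? ys                      ∎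
      where open ≡-Reasoning
    filter-beside-head before ¬Px Pv ys = begin
      filter P? (insertBefore x v (x ∷ ys)) ≡⟨ cong (filter P?) (insertBefore-head x v ys) ⟩
      filter P? (v ∷ x ∷ ys)                ≡⟨ filter-accept P? Pv ⟩
      v ∷ filter P? (x ∷ ys)                ≡⟨ cong (v ∷_) (filter-reject P? ¬Px) ⟩
      v ∷ filter P? ys                      ∎
      where open ≡-Reasoning

filter-initPerm : ∀ {s} {P : Pred (Letter s) ℓ} (P? : Decidable P) {k x y} → 1 ≤ x → x < y → y ≤ k →
  P (cl x) → P (cl y) → (∀ j → P (cl j) → j ≡ x ⊎ j ≡ y) → filter P? (initPerm k) ≡ cl x ∷ cl y ∷ []
filter-initPerm P? {k} {suc x} {suc y} _ (s≤s x<y) y≤k Px Py only =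
  trans (cong (filter P?) (map-upTo (cl ∘ suc) k))
        (filter-applyUpTo-two P? (cl ∘ suc) x<y y≤k Px Py
          (λ j → Sum.map suc-injective suc-injective ∘ only (suc j)))

anchor₁ anchor₂ : Nbhd → ℕ
anchor₁ (nbA m _) = m
anchor₁ (nbB l _) = l
anchor₂ (nbA _ n) = n
anchor₂ (nbB _ r) = r

module _ (k s : ℕ) (N : Fin s → Nbhd) where
  open Construction k s N

  step1-beside : ∀ c → Beside (cl (anchor₁ (N c))) (iv c) (λ p → step1 p c)
  step1-beside c with N c
  ... | nbA _ _ = after
  ... | nbB _ _ = before

  step2-beside : ∀ c → Beside (cl (anchor₂ (N c))) (iv c) (λ p → step2 p c)
  step2-beside c with N c
  ... | nbA _ _ = before
  ... | nbB _ _ = after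

module Restriction (k s : ℕ) (a : Fin s) (b : ℕ) where
  open import Data.List.Membership.DecPropositional (_≟L_ {s}) using (_∈?_)

  S₂ : List (Letter s)
  S₂ = iv a ∷ cl b ∷ []

  iv-a∈S₂ : iv a ∈ S₂
  iv-a∈S₂ = here refl

  cl-b∈S₂ : cl b ∈ S₂
  cl-b∈S₂ = there (here refl)

  module Placement (f : List (Letter s) → Fin s → List (Letter s)) (anchor : Fin s → ℕ)
                   (beside : ∀ c → Beside (cl (anchor c)) (iv c) (λ p → f p c)) where

    placed : List (Letter s)
    placed = foldl f (initPerm k) (allFin s)

    private
      t : ℕ
      t = anchor a

      S₃ : List (Letter s)
      S₃ = cl t ∷ S₂

      cl∈S₃ : ∀ j → cl j ∈ S₃ → j ≡ t ⊎ j ≡ b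
      cl∈S₃ j (here refl)                = inj₁ refl
      cl∈S₃ j (there (there (here refl))) = inj₂ refl

      iv∉S₃ : ∀ {c} → c ≢ a → ¬ iv c ∈ S₃
      iv∉S₃ c≢a (there (here refl)) = c≢a refl
      iv∉S₃ _ (there (there (here ())))
      iv∉S₃ _ (there (there (there ())))

      cl∉S₂ : t ≢ b → ¬ cl t ∈ S₂
      cl∉S₂ t≢b (there (here refl)) = t≢b refl

      placed-↾S₃ : placed ↾ S₃ ≡ f (initPerm k ↾ S₃) a
      placed-↾S₃ = filter-foldl-unique (_∈? S₃) f others (λ p → f p a)
        (filter-beside-accept (_∈? S₃) (beside a) (here refl) (there iv-a∈S₂))
        (allFin⁺ s) (∈-allFin a) (initPerm k)
        where
        others : ∀ {c} p → c ≢ a → f p c ↾ S₃ ≡ p ↾ S₃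
        others {c} p c≢a = filter-beside-reject (_∈? S₃) (beside c) (iv∉S₃ c≢a) p

      placed-↾S₂ : placed ↾ S₂ ≡ f (initPerm k ↾ S₃) a ↾ S₂
      placed-↾S₂ = begin
        placed ↾ S₂                 ≡⟨ filter-filter-⊆ (_∈? S₃) (_∈? S₂) there placed ⟨
        placed ↾ S₃ ↾ S₂            ≡⟨ cong (_↾ S₂) placed-↾S₃ ⟩
        f (initPerm k ↾ S₃) a ↾ S₂  ∎
        where open ≡-Reasoning

    placed-below : ∀ {u} → anchor a ≡ u → 1 ≤ u → u < b → b ≤ k → placed ↾ S₂ ≡ iv a ∷ cl b ∷ []
    placed-below refl 1≤t t<b b≤k = begin
      placed ↾ S₂
        ≡⟨ placed-↾S₂ ⟩
      f (initPerm k ↾ S₃) a ↾ S₂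
        ≡⟨ cong (λ p → f p a ↾ S₂) init-↾S₃ ⟩
      f (cl t ∷ cl b ∷ []) a ↾ S₂
        ≡⟨ filter-beside-head (_∈? S₂) (beside a) (cl∉S₂ (<⇒≢ t<b)) iv-a∈S₂ _ ⟩
      iv a ∷ (cl b ∷ []) ↾ S₂
        ≡⟨ cong (iv a ∷_) (filter-accept (_∈? S₂) cl-b∈S₂) ⟩
      iv a ∷ cl b ∷ []
        ∎
      where
      open ≡-Reasoning
      init-↾S₃ : initPerm k ↾ S₃ ≡ cl t ∷ cl b ∷ []
      init-↾S₃ = filter-initPerm (_∈? S₃) 1≤t t<b b≤k (here refl) (there cl-b∈S₂) cl∈S₃

    placed-above : ∀ {u} → anchor a ≡ u → 1 ≤ b → b < u → u ≤ k → placed ↾ S₂ ≡ cl b ∷ iv a ∷ []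
    placed-above refl 1≤b b<t t≤k = begin
      placed ↾ S₂
        ≡⟨ placed-↾S₂ ⟩
      f (initPerm k ↾ S₃) a ↾ S₂
        ≡⟨ cong (λ p → f p a ↾ S₂) init-↾S₃ ⟩
      f (cl b ∷ cl t ∷ []) a ↾ S₂
        ≡⟨ cong (_↾ S₂) (beside-cons (beside a) (λ { refl → <⇒≢ b<t refl }) _) ⟩
      (cl b ∷ f (cl t ∷ []) a) ↾ S₂
        ≡⟨ filter-accept (_∈? S₂) cl-b∈S₂ ⟩
      cl b ∷ f (cl t ∷ []) a ↾ S₂
        ≡⟨ cong (cl b ∷_) (filter-beside-head (_∈? S₂) (beside a) (cl∉S₂ (>⇒≢ b<t)) iv-a∈S₂ []) ⟩
      cl b ∷ iv a ∷ []
        ∎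
      where
      open ≡-Reasoning
      init-↾S₃ : initPerm k ↾ S₃ ≡ cl b ∷ cl t ∷ []
      init-↾S₃ = filter-initPerm (_∈? S₃) 1≤b b<t t≤k (there cl-b∈S₂) (here refl)
                                 (λ j → Sum.swap ∘ cl∈S₃ j)

AltFrom-square-free : ∀ {s} {x y : Letter s} → x ≢ y → ∀ u {z v} → ¬ AltFrom x y (u ++ z ∷ z ∷ v)
AltFrom-square-free x≢y []      (alt∷ (alt∷ _)) = x≢y refl
AltFrom-square-free x≢y (_ ∷ u) (alt∷ alt)      = AltFrom-square-free (x≢y ∘ sym) u alt

¬Alternate-square : ∀ {s} {x y : Letter s} {w} → x ≢ y → ∀ u {z v} →
  restrict x y w ≡ u ++ z ∷ z ∷ v → ¬ Alternate x y w
¬Alternate-square x≢y u eq (inj₁ alt) = AltFrom-square-free x≢y u (subst (AltFrom _ _) eq alt)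
¬Alternate-square x≢y u eq (inj₂ alt) = AltFrom-square-free (x≢y ∘ sym) u (subst (AltFrom _ _) eq alt)

module Word (k s : ℕ) (N : Fin s → Nbhd) (a : Fin s) (b : ℕ) where
  open Construction k s N
  open Restriction k s a b
  open import Data.List.Membership.DecPropositional (_≟L_ {s}) using (_∈?_)

  module P₁ = Placement step1 (anchor₁ ∘ N) (step1-beside k s N)
  module P₂ = Placement step2 (anchor₂ ∘ N) (step2-beside k s N)

  restrict-w : ∀ {u₁ u₂ u₃} → p1 ↾ S₂ ≡ u₁ → filterᵇ isB u₁ ≡ u₃ → p2 ↾ S₂ ≡ u₂ →
    restrict (iv a) (cl b) w ≡ u₁ ++ reverse u₃ ++ u₂ ++ p3 ↾ S₂
  restrict-w refl refl refl = begin
    restrict (iv a) (cl b) w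
      ≡⟨ restrict-↾ (iv a) (cl b) w ⟩
    (p1 ++ B₁ ++ p2 ++ p3) ↾ S₂
      ≡⟨ ↾-++ p1 _ ⟩
    p1 ↾ S₂ ++ (B₁ ++ p2 ++ p3) ↾ S₂
      ≡⟨ cong (p1 ↾ S₂ ++_) (↾-++ B₁ _) ⟩
    p1 ↾ S₂ ++ B₁ ↾ S₂ ++ (p2 ++ p3) ↾ S₂
      ≡⟨ cong (λ u → p1 ↾ S₂ ++ u ++ (p2 ++ p3) ↾ S₂) B₁-↾ ⟩
    p1 ↾ S₂ ++ reverse (filterᵇ isB (p1 ↾ S₂)) ++ (p2 ++ p3) ↾ S₂
      ≡⟨ cong (λ u → p1 ↾ S₂ ++ reverse (filterᵇ isB (p1 ↾ S₂)) ++ u) (↾-++ p2 p3) ⟩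
    p1 ↾ S₂ ++ reverse (filterᵇ isB (p1 ↾ S₂)) ++ p2 ↾ S₂ ++ p3 ↾ S₂
      ∎
    where
    open ≡-Reasoning
    B₁ : List (Letter s)
    B₁ = reverse (filterᵇ isB p1)
    ↾-++ : ∀ xs ys → (xs ++ ys) ↾ S₂ ≡ xs ↾ S₂ ++ ys ↾ S₂
    ↾-++ = filter-++ (_∈? S₂)
    B₁-↾ : B₁ ↾ S₂ ≡ reverse (filterᵇ isB (p1 ↾ S₂))
    B₁-↾ = trans (filter-reverse (_∈? S₂) (filterᵇ isB p1))
                 (cong reverse (filter-comm (_∈? S₂) (T? ∘ isB) p1))

  ¬Alternate-w : ∀ u {z v} → restrict (iv a) (cl b) w ≡ u ++ z ∷ z ∷ v → ¬ Alternate (iv a) (cl b) w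
  ¬Alternate-w = ¬Alternate-square {w = w} (λ ())

  filterᵇ-isB-A : ∀ {m n} → N a ≡ nbA m n → filterᵇ isB S₂ ≡ []
  filterᵇ-isB-A eq rewrite eq = refl

  filterᵇ-isB-B : ∀ {l r} → N a ≡ nbB l r → ∀ us → filterᵇ isB (iv a ∷ us) ≡ iv a ∷ filterᵇ isB us
  filterᵇ-isB-B eq us rewrite eq = refl

lemma4 : (k s : ℕ) (N : Fin s → Nbhd)
    → (∀ a → WellFormed k (N a))
    → (∀ a b → Cond2 (N a) (N b))
    → (∀ a b → Cond3 (N a) (N b))
    → (a : Fin s) (b : ℕ) → 1 ≤ b → b ≤ k → ¬ Adj k (N a) b
    → ¬ Alternate (iv a) (cl b) (Construction.w k s N)
lemma4 k s N wf _ _ a b 1≤b b≤k ¬adj with N a in eq | wf a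
... | nbA m n | 1≤m , _ , n≤k =
  ¬Alternate-w (iv a ∷ [])
    (restrict-w (P₁.placed-below (cong anchor₁ eq) 1≤m m<b b≤k)
                (filterᵇ-isB-A eq)
                (P₂.placed-above (cong anchor₂ eq) 1≤b b<n n≤k))
  where
  open Word k s N a b
  m<b : m < b
  m<b = ≰⇒> (¬adj ∘ inj₁ ∘ (1≤b ,_))
  b<n : b < n
  b<n = ≰⇒> (¬adj ∘ inj₂ ∘ (_, b≤k))
... | nbB l r | 1≤l , l≤r , r≤k , _ with l ≤? b
...   | no l≰b =
  ¬Alternate-w (cl b ∷ [])
    (restrict-w (P₁.placed-above (cong anchor₁ eq) 1≤b b<l (≤-trans l≤r r≤k))
                (filterᵇ-isB-B eq [])
                (P₂.placed-above (cong anchor₂ eq) 1≤b (<-≤-trans b<l l≤r) r≤k))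
  where
  open Word k s N a b
  b<l : b < l
  b<l = ≰⇒> l≰b
...   | yes l≤b =
  ¬Alternate-w (iv a ∷ cl b ∷ [])
    (restrict-w (P₁.placed-below (cong anchor₁ eq) 1≤l (≤-<-trans l≤r r<b) b≤k)
                (filterᵇ-isB-B eq (cl b ∷ []))
                (P₂.placed-below (cong anchor₂ eq) (≤-trans 1≤l l≤r) r<b b≤k))
  where
  open Word k s N a b
  r<b : r < b
  r<b = ≰⇒> (¬adj ∘ (l≤b ,_))
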